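{- Let $q=p^r$ with $p$ prime and $r$ a positive integer. A point of $\mathbb{P}^2(\mathbb{F}_{q^2})$ lies on the curve $u^{q-1}+v^{q-1}+w^{q-1}=0$ if and only if it is of one of the following forms: (1) when $q\equiv 2\pmod 3$: $(c v^2 : v : 1)$ with $c\in\mathbb{F}_q^*$ and $v\in\mathbb{F}_{q^2}$ such that $v^{q-1}$ is a primitive cube root of unity; (2) when $q\equiv 0\pmod 3$: $(u:v:1)$ with $u,v\in\mathbb{F}_q^*$; (3) $(u:v:w)$ where $(u,v,w)$ is a permutation of $(0,1,d)$ for some $d\in\mathbb{F}_{q^2}$ with $d^{q-1}=-1$.
   Context: $\mathbb{F}_{q^2}$ is the finite field with $q^2$ elements and $\mathbb{P}^2(\mathbb{F}_{q^2})$ the projective plane over it; $\mathbb{F}_q^*$ is the multiplicative group of $\mathbb{F}_q$. -}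

module Defs where

open import Level using (_⊔_)
open import Data.Nat using (ℕ; _∸_)
open import Data.Product using (Σ; ∃; _×_)
open import Data.Sum using (_⊎_)
open import Data.Fin using (Fin)
open import Relation.Nullary using (¬_)
open import Relation.Binary.PropositionalEquality using () renaming (setoid to ≡-setoid)
open import Algebra.Bundles using (CommutativeRing; Semiring)
open import Function.Bundles using (Inverse)

module FieldDefs {c ℓ} (K : CommutativeRing c ℓ) where
  open CommutativeRing K renaming (Carrier to F)
  open import Algebra.Definitions.RawSemiring (Semiring.rawSemiring semiring) using (_^_)

  IsField : Set (c ⊔ ℓ)
  IsField = (¬ (0# ≈ 1#)) × (∀ x → ¬ (x ≈ 0#) → ∃ λ y → x * y ≈ 1#)

  HasCard : ℕ → Set (c ⊔ ℓ)
  HasCard n = Inverse setoid′ (≡-setoid (Fin n))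
    where setoid′ = CommutativeRing.setoid K

  -- x lies in the subfield F_q = { x | x^q = x } of F_{q^2}
  InFq : ℕ → F → Set ℓ
  InFq q x = x ^ q ≈ x

  InFq* : ℕ → F → Set ℓ
  InFq* q x = InFq q x × ¬ (x ≈ 0#)

  PrimitiveCubeRoot : F → Set ℓ
  PrimitiveCubeRoot ω = (ω ^ 3 ≈ 1#) × ¬ (ω ≈ 1#)

  NonZeroTriple : F → F → F → Set ℓ
  NonZeroTriple u v w = ¬ ((u ≈ 0#) × (v ≈ 0#) × (w ≈ 0#))

  SamePoint : F → F → F → F → F → F → Set (c ⊔ ℓ)
  SamePoint u v w a b e =
    ∃ λ t → ¬ (t ≈ 0#) × (u ≈ t * a) × (v ≈ t * b) × (w ≈ t * e)

  OnCurve : ℕ → F → F → F → Set ℓ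
  OnCurve q u v w = (u ^ (q ∸ 1)) + (v ^ (q ∸ 1)) + (w ^ (q ∸ 1)) ≈ 0#

  -- form (1) without the congruence condition: (c v² : v : 1)
  Form1 : ℕ → F → F → F → Set (c ⊔ ℓ)
  Form1 q u v w = ∃ λ a → ∃ λ y →
    InFq* q a × PrimitiveCubeRoot (y ^ (q ∸ 1)) × SamePoint u v w (a * (y * y)) y 1#

  -- form (2) without the congruence condition: (a : b : 1), a b ∈ F_q^*
  Form2 : ℕ → F → F → F → Set (c ⊔ ℓ)
  Form2 q u v w = ∃ λ a → ∃ λ b → InFq* q a × InFq* q b × SamePoint u v w a b 1#

  Form3 : ℕ → F → F → F → Set (c ⊔ ℓ)
  Form3 q u v w = ∃ λ d → (d ^ (q ∸ 1) ≈ - 1#) ×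
    ( SamePoint u v w 0# 1# d ⊎ SamePoint u v w 0# d 1#
    ⊎ SamePoint u v w 1# 0# d ⊎ SamePoint u v w 1# d 0#
    ⊎ SamePoint u v w d 0# 1# ⊎ SamePoint u v w d 1# 0# )

-- With all coordinates nonzero, dehomogenise to w = 1 and put α = u^(q-1), β = v^(q-1), so
-- α + β + 1 = 0. Since z^(q-1) has norm z^(q²-1) = 1, α^q = α⁻¹ and β^q = β⁻¹, and applying the
-- additive map x ↦ x^q to the line gives α⁻¹ + β⁻¹ + 1 = 0; hence αβ = 1 and α² + α + 1 = 0.
-- Either α = β = 1, which forces 3 = 0 and u, v ∈ F_q, or α is a primitive cube root of unity
-- inverted by x ↦ x^q, which forces q ≡ 2 (mod 3) and u/v² ∈ F_q. When a coordinate vanishes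
-- the other two have a ratio d with d^(q-1) = -1.
module Submission where

open import Defs

open import Level using (_⊔_)
open import Data.Nat as ℕ using (ℕ; zero; suc; _∸_; _!; _%_; _/_; _<_; _≤_; z≤n; s≤s; NonZero)
import Data.Nat.Properties as ℕ
open import Data.Nat.Divisibility using (_∣_; divides; ∣⇒≤; ∣1⇒≡1; m∣m*n; m%n≡0⇒n∣m; n∣m⇒m%n≡0)
open import Data.Nat.DivMod using (m%n<n; m/n*n≡m; m≡m%n+[m/n]*n)
open import Data.Nat.Primality using (Prime; euclidsLemma; prime⇒irreducible; prime⇒nonTrivial; prime⇒nonZero; prime?)
open import Data.Nat.Combinatorics using (_C_; nCn≡1; k![n∸k]!∣n!)
open import Data.Nat.Combinatorics.Specification using (nCk≡n!/k![n-k]!)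
open import Data.Fin as Fin using (Fin; toℕ; inject₁; punchIn)
import Data.Fin.Properties as Fin
open import Data.Fin.Permutation using (Permutation; permutation)
open import Data.Vec.Functional using (replicate; tail; init; last)
open import Data.Product using (∃; _,_; proj₁; proj₂)
open import Data.Sum using (_⊎_; inj₁; inj₂; [_,_]′; reduce)
open import Function.Base using (id)
open import Data.Empty using (⊥-elim)
open import Relation.Nullary using (¬_; yes; no)
open import Relation.Nullary.Decidable using (from-yes)
open import Relation.Binary.Definitions using (Decidable)
open import Relation.Binary.PropositionalEquality as ≡ using (_≡_; _≢_)
open import Algebra.Bundles using (CommutativeRing; Ring)
open import Function.Bundles using (_⇔_; mk⇔; Inverse; Equivalence)
import Algebra.Properties.CommutativeMonoid.Sum as CommutativeMonoidSum

prime⇒2≤ : ∀ {p} → Prime p → 2 ≤ p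
prime⇒2≤ {p} p-prime = ℕ.nonTrivial⇒n>1 p {{prime⇒nonTrivial p-prime}}

prime^suc≥2 : ∀ {p} → Prime p → ∀ r → 2 ≤ p ℕ.^ suc r
prime^suc≥2 {p} p-prime r =
  ℕ.≤-trans (prime⇒2≤ p-prime) (ℕ.m≤m*n p (p ℕ.^ r) {{ℕ.m^n≢0 p r {{prime⇒nonZero p-prime}}}})

≥2⇒≡2+ : ∀ {n} → 2 ≤ n → ∃ λ m → n ≡ suc (suc m)
≥2⇒≡2+ (s≤s (s≤s {n = m} _)) = m , ≡.refl

prime∤! : ∀ {p} → Prime p → ∀ m → m < p → ¬ (p ∣ m !)
prime∤! p-prime zero _ p∣1 with ∣1⇒≡1 p∣1 | prime⇒2≤ p-prime
... | ≡.refl | s≤s ()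
prime∤! p-prime (suc m) m<p p∣m! with euclidsLemma (suc m) (m !) p-prime p∣m!
... | inj₁ p∣1+m = ℕ.<⇒≱ m<p (∣⇒≤ p∣1+m)
... | inj₂ p∣m!  = prime∤! p-prime m (ℕ.<-trans (ℕ.n<1+n m) m<p) p∣m!

-- p divides p! = (p C k) * k! * (p ∸ k)! but neither factorial.
prime∣C : ∀ {p} → Prime p → ∀ k → 0 < k → k < p → p ∣ p C k
prime∣C {p} p-prime k 0<k k<p with euclidsLemma (p C k) (k ! ℕ.* (p ∸ k) !) p-prime p∣product
  where
  product≡p! : (p C k) ℕ.* (k ! ℕ.* (p ∸ k) !) ≡ p !
  product≡p! = ≡.trans (≡.cong (ℕ._* (k ! ℕ.* (p ∸ k) !)) (nCk≡n!/k![n-k]! (ℕ.<⇒≤ k<p)))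
                       (m/n*n≡m {{ℕ._!*_!≢0 k (p ∸ k)}} (k![n∸k]!∣n! (ℕ.<⇒≤ k<p)))
  n∣n! : ∀ n → 0 < n → n ∣ n !
  n∣n! (suc n) _ = m∣m*n (n !)
  p∣product : p ∣ (p C k) ℕ.* (k ! ℕ.* (p ∸ k) !)
  p∣product = ≡.subst (p ∣_) (≡.sym product≡p!) (n∣n! p (ℕ.<-trans 0<k k<p))
... | inj₁ p∣C = p∣C
... | inj₂ p∣k!*[p∸k]! with euclidsLemma (k !) ((p ∸ k) !) p-prime p∣k!*[p∸k]!
...   | inj₁ p∣k! = ⊥-elim (prime∤! p-prime k k<p p∣k!)
...   | inj₂ p∣[p∸k]! = ⊥-elim (prime∤! p-prime (p ∸ k) (ℕ.∸-monoʳ-< 0<k (ℕ.<⇒≤ k<p)) p∣[p∸k]!)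

prime∣^⇒∣ : ∀ {d} → Prime d → ∀ m n → d ∣ m ℕ.^ n → d ∣ m
prime∣^⇒∣ d-prime m zero d∣1 with ∣1⇒≡1 d∣1 | prime⇒2≤ d-prime
... | ≡.refl | s≤s ()
prime∣^⇒∣ d-prime m (suc n) d∣m^1+n with euclidsLemma m (m ℕ.^ n) d-prime d∣m^1+n
... | inj₁ d∣m = d∣m
... | inj₂ d∣m^n = prime∣^⇒∣ d-prime m n d∣m^n

∣prime⇒≡ : ∀ {p d} → Prime p → d ∣ p → d ≢ 1 → d ≡ p
∣prime⇒≡ p-prime d∣p d≢1 with prime⇒irreducible p-prime d∣p
... | inj₁ d≡1 = ⊥-elim (d≢1 d≡1)
... | inj₂ d≡p = d≡p

%3-cases : ∀ n → n % 3 ≡ 0 ⊎ n % 3 ≡ 1 ⊎ n % 3 ≡ 2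
%3-cases n with n % 3 | m%n<n n 3
... | 0 | _ = inj₁ ≡.refl
... | 1 | _ = inj₂ (inj₁ ≡.refl)
... | 2 | _ = inj₂ (inj₂ ≡.refl)
... | suc (suc (suc _)) | s≤s (s≤s (s≤s ()))

module CommutativeRingProperties {c ℓ} (K : CommutativeRing c ℓ) where
  open CommutativeRing K renaming (Carrier to F)
  open import Algebra.Properties.Semiring.Exp semiring
  open import Algebra.Properties.CommutativeSemiring.Exp commutativeSemiring using (^-distrib-*)
  open import Algebra.Properties.Semiring.Mult semiring using (_×_; ×-homo-+; ×1-homo-*; ×-assoc-*; ×-congʳ)
  open import Algebra.Properties.RingWithoutOne (Ring.ringWithoutOne ring) using (+-cancelˡ; +-cancelʳ)
  open import Algebra.Solver.Ring.NaturalCoefficients.Default commutativeSemiring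
  open import Relation.Binary.Reasoning.Setoid setoid
  module ∏ = CommutativeMonoidSum *-commutativeMonoid

  1^n≈1 : ∀ n → 1# ^ n ≈ 1#
  1^n≈1 zero    = refl
  1^n≈1 (suc n) = trans (*-identityˡ _) (1^n≈1 n)

  ×1-homo-^ : ∀ n k → (n ℕ.^ k) × 1# ≈ (n × 1#) ^ k
  ×1-homo-^ n zero    = +-identityʳ 1#
  ×1-homo-^ n (suc k) = trans (×1-homo-* n (n ℕ.^ k)) (*-congˡ (×1-homo-^ n k))

  ×≈×1* : ∀ n x → n × x ≈ (n × 1#) * x
  ×≈×1* n x = trans (×-congʳ n (sym (*-identityˡ x))) (sym (×-assoc-* n 1# x))

  ∣∧×1≈0⇒×≈0 : ∀ {m n} → n ∣ m → n × 1# ≈ 0# → ∀ x → m × x ≈ 0#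
  ∣∧×1≈0⇒×≈0 {n = n} (divides d ≡.refl) n×1≈0 x = begin
    (d ℕ.* n) × x             ≈⟨ ×≈×1* (d ℕ.* n) x ⟩
    ((d ℕ.* n) × 1#) * x      ≈⟨ *-congʳ (×1-homo-* d n) ⟩
    ((d × 1#) * (n × 1#)) * x ≈⟨ *-congʳ (*-congˡ n×1≈0) ⟩
    ((d × 1#) * 0#) * x       ≈⟨ *-congʳ (zeroʳ _) ⟩
    0# * x                    ≈⟨ zeroˡ x ⟩
    0#                        ∎

  %-×1≈0 : ∀ m n .{{_ : NonZero n}} → m × 1# ≈ 0# → n × 1# ≈ 0# → (m % n) × 1# ≈ 0#
  %-×1≈0 m n m×1≈0 n×1≈0 = +-cancelʳ ((m / n ℕ.* n) × 1#) _ _ (begin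
    (m % n) × 1# + (m / n ℕ.* n) × 1# ≈⟨ ×-homo-+ 1# (m % n) _ ⟨
    (m % n ℕ.+ m / n ℕ.* n) × 1#      ≡⟨ ≡.cong (_× 1#) (m≡m%n+[m/n]*n m n) ⟨
    m × 1#                            ≈⟨ m×1≈0 ⟩
    0#                                ≈⟨ ∣∧×1≈0⇒×≈0 {n = n} (m∣m*n (m / n)) n×1≈0 1# ⟨
    (n ℕ.* (m / n)) × 1#              ≡⟨ ≡.cong (_× 1#) (ℕ.*-comm n (m / n)) ⟩
    (m / n ℕ.* n) × 1#                ≈⟨ +-identityˡ _ ⟨
    0# + (m / n ℕ.* n) × 1#           ∎)

  ∏-constant-but-one : ∀ {n} (v : Fin n → F) (i₀ : Fin n) x →
    v i₀ ≈ 1# → (∀ i → i ≢ i₀ → v i ≈ x) → ∏.sum v ≈ x ^ (n ∸ 1)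
  ∏-constant-but-one {suc n} v i₀ x vi₀≈1 vi≈x = begin
    ∏.sum v                               ≈⟨ ∏.sum-remove {i = i₀} v ⟩
    v i₀ * ∏.sum (λ j → v (punchIn i₀ j)) ≈⟨ *-cong vi₀≈1 (∏.sum-cong-≋ (λ j → vi≈x _ (Fin.punchInᵢ≢i i₀ j))) ⟩
    1# * ∏.sum (replicate n x)            ≈⟨ *-identityˡ _ ⟩
    ∏.sum (replicate n x)                 ≈⟨ ∏.sum-replicate n ⟩
    x ^ n                                 ∎

  -- With A, B the inverses of x, y: 1/x + 1/y = (x + y)/(xy) forces xy = 1 when both sums are -1.
  x+y≈x⁻¹+y⁻¹⇒x*y≈1 : ∀ x y A B → x + y + 1# ≈ 0# → A + B + 1# ≈ 0# →
    x * A ≈ 1# → y * B ≈ 1# → x * y ≈ 1#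
  x+y≈x⁻¹+y⁻¹⇒x*y≈1 x y A B x+y+1≈0 A+B+1≈0 xA≈1 yB≈1 = sym (+-cancelˡ (y + x) 1# (x * y) (begin
    y + x + 1#                         ≈⟨ solve 2 (λ x y → y :+ x :+ con 1 := x :+ y :+ con 1) refl x y ⟩
    x + y + 1#                         ≈⟨ x+y+1≈0 ⟩
    0#                                 ≈⟨ zeroʳ _ ⟨
    (x * y) * 0#                       ≈⟨ *-congˡ A+B+1≈0 ⟨
    (x * y) * (A + B + 1#)             ≈⟨ solve 4 (λ x y A B → (x :* y) :* (A :+ B :+ con 1) := (x :* A) :* y :+ (y :* B) :* x :+ x :* y) refl x y A B ⟩
    (x * A) * y + (y * B) * x + x * y  ≈⟨ +-congʳ (+-cong (trans (*-congʳ xA≈1) (*-identityˡ y)) (trans (*-congʳ yB≈1) (*-identityˡ x))) ⟩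
    y + x + x * y                      ∎))

  x+y+1≈0⇒x*x+x+1≈0 : ∀ x y → x + y + 1# ≈ 0# → x * y ≈ 1# → x * x + x + 1# ≈ 0#
  x+y+1≈0⇒x*x+x+1≈0 x y x+y+1≈0 xy≈1 = begin
    x * x + x + 1#     ≈⟨ +-congˡ xy≈1 ⟨
    x * x + x + x * y  ≈⟨ solve 2 (λ x y → x :* x :+ x :+ x :* y := x :* (x :+ y :+ con 1)) refl x y ⟩
    x * (x + y + 1#)   ≈⟨ *-congˡ x+y+1≈0 ⟩
    x * 0#             ≈⟨ zeroʳ x ⟩
    0#                 ∎

  x*x+x+1≈0⇒x^3≈1 : ∀ x → x * x + x + 1# ≈ 0# → x ^ 3 ≈ 1#
  x*x+x+1≈0⇒x^3≈1 x x²+x+1≈0 = +-cancelʳ (x * x + x) (x ^ 3) 1# (begin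
    x ^ 3 + (x * x + x)  ≈⟨ solve 1 (λ x → x :^ 3 :+ (x :* x :+ x) := x :* (x :* x :+ x :+ con 1)) refl x ⟩
    x * (x * x + x + 1#) ≈⟨ *-congˡ x²+x+1≈0 ⟩
    x * 0#               ≈⟨ zeroʳ x ⟩
    0#                   ≈⟨ x²+x+1≈0 ⟨
    x * x + x + 1#       ≈⟨ solve 1 (λ x → x :* x :+ x :+ con 1 := con 1 :+ (x :* x :+ x)) refl x ⟩
    1# + (x * x + x)     ∎)

  ^-reduce-mod3 : ∀ x → x ^ 3 ≈ 1# → ∀ n → x ^ n ≈ x ^ (n % 3)
  ^-reduce-mod3 x x³≈1 n = begin
    x ^ n                            ≡⟨ ≡.cong (x ^_) (m≡m%n+[m/n]*n n 3) ⟩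
    x ^ (n % 3 ℕ.+ n / 3 ℕ.* 3)      ≈⟨ ^-homo-* x (n % 3) _ ⟩
    x ^ (n % 3) * x ^ (n / 3 ℕ.* 3)  ≡⟨ ≡.cong (λ k → x ^ (n % 3) * x ^ k) (ℕ.*-comm (n / 3) 3) ⟩
    x ^ (n % 3) * x ^ (3 ℕ.* (n / 3)) ≈⟨ *-congˡ (^-assocʳ x 3 (n / 3)) ⟨
    x ^ (n % 3) * (x ^ 3) ^ (n / 3)  ≈⟨ *-congˡ (trans (^-congˡ (n / 3) x³≈1) (1^n≈1 (n / 3))) ⟩
    x ^ (n % 3) * 1#                 ≈⟨ *-identityʳ _ ⟩
    x ^ (n % 3)                      ∎

  x^3≈1∧x*y≈1⇒y*y≈x : ∀ x y → x ^ 3 ≈ 1# → x * y ≈ 1# → y * y ≈ x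
  x^3≈1∧x*y≈1⇒y*y≈x x y x³≈1 xy≈1 = begin
    y * y                    ≈⟨ *-identityʳ _ ⟨
    y * y * 1#               ≈⟨ *-congˡ x³≈1 ⟨
    y * y * x ^ 3            ≈⟨ solve 2 (λ x y → y :* y :* x :^ 3 := (x :* y) :* (x :* y) :* x) refl x y ⟩
    (x * y) * (x * y) * x    ≈⟨ *-congʳ (*-cong xy≈1 xy≈1) ⟩
    1# * 1# * x              ≈⟨ solve 1 (λ x → con 1 :* con 1 :* x := x) refl x ⟩
    x                        ∎

  x^3≈1∧x*y≈1⇒y^3≈1 : ∀ x y → x ^ 3 ≈ 1# → x * y ≈ 1# → y ^ 3 ≈ 1#
  x^3≈1∧x*y≈1⇒y^3≈1 x y x³≈1 xy≈1 = begin
    y ^ 3          ≈⟨ *-identityˡ _ ⟨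
    1# * y ^ 3     ≈⟨ *-congʳ x³≈1 ⟨
    x ^ 3 * y ^ 3  ≈⟨ ^-distrib-* x y 3 ⟨
    (x * y) ^ 3    ≈⟨ ^-congˡ 3 xy≈1 ⟩
    1# ^ 3         ≈⟨ 1^n≈1 3 ⟩
    1#             ∎

  x^3≈1∧x*x^n≈1⇒n%3≡2 : ∀ x n → x ^ 3 ≈ 1# → x ≉ 1# → x * x ^ n ≈ 1# → n % 3 ≡ 2
  x^3≈1∧x*x^n≈1⇒n%3≡2 x n x³≈1 x≉1 xxⁿ≈1 with n % 3 | %3-cases n | ^-reduce-mod3 x x³≈1 n
  ... | _ | inj₁ ≡.refl | xⁿ≈1 = ⊥-elim (x≉1 (begin
    x            ≈⟨ *-identityʳ x ⟨
    x * 1#       ≈⟨ *-congˡ xⁿ≈1 ⟨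
    x * x ^ n    ≈⟨ xxⁿ≈1 ⟩
    1#           ∎))
  ... | _ | inj₂ (inj₁ ≡.refl) | xⁿ≈x = ⊥-elim (x≉1 (begin
    x            ≈⟨ *-identityʳ x ⟨
    x * 1#       ≈⟨ *-congˡ xxⁿ≈1 ⟨
    x * (x * x ^ n)  ≈⟨ *-congˡ (*-congˡ xⁿ≈x) ⟩
    x ^ 3        ≈⟨ x³≈1 ⟩
    1#           ∎))
  ... | _ | inj₂ (inj₂ ≡.refl) | _ = ≡.refl

module Field {c ℓ} (K : CommutativeRing c ℓ) (isField : FieldDefs.IsField K) where
  open CommutativeRing K renaming (Carrier to F)
  open import Algebra.Properties.Semiring.Exp semiring using (_^_)
  open import Algebra.Solver.Ring.NaturalCoefficients.Default commutativeSemiring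
  open import Relation.Binary.Reasoning.Setoid setoid
  module ∏ = CommutativeMonoidSum *-commutativeMonoid

  0≉1 : 0# ≉ 1#
  0≉1 = proj₁ isField

  1≉0 : 1# ≉ 0#
  1≉0 1≈0 = 0≉1 (sym 1≈0)

  _⁻¹⟨_⟩ : ∀ x → x ≉ 0# → F
  x ⁻¹⟨ x≉0 ⟩ = proj₁ (proj₂ isField x x≉0)

  *-inverseʳ : ∀ x (x≉0 : x ≉ 0#) → x * x ⁻¹⟨ x≉0 ⟩ ≈ 1#
  *-inverseʳ x x≉0 = proj₂ (proj₂ isField x x≉0)

  *-inverseˡ : ∀ x (x≉0 : x ≉ 0#) → x ⁻¹⟨ x≉0 ⟩ * x ≈ 1#
  *-inverseˡ x x≉0 = trans (*-comm _ _) (*-inverseʳ x x≉0)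

  ⁻¹-≉0 : ∀ x (x≉0 : x ≉ 0#) → x ⁻¹⟨ x≉0 ⟩ ≉ 0#
  ⁻¹-≉0 x x≉0 x⁻¹≈0 = 0≉1 (trans (sym (trans (*-congˡ x⁻¹≈0) (zeroʳ x))) (*-inverseʳ x x≉0))

  *-cancelˡ : ∀ a x y → a ≉ 0# → a * x ≈ a * y → x ≈ y
  *-cancelˡ a x y a≉0 ax≈ay = begin
    x                       ≈⟨ *-identityˡ x ⟨
    1# * x                  ≈⟨ *-congʳ (*-inverseˡ a a≉0) ⟨
    (a ⁻¹⟨ a≉0 ⟩ * a) * x   ≈⟨ *-assoc _ _ _ ⟩
    a ⁻¹⟨ a≉0 ⟩ * (a * x)   ≈⟨ *-congˡ ax≈ay ⟩
    a ⁻¹⟨ a≉0 ⟩ * (a * y)   ≈⟨ *-assoc _ _ _ ⟨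
    (a ⁻¹⟨ a≉0 ⟩ * a) * y   ≈⟨ *-congʳ (*-inverseˡ a a≉0) ⟩
    1# * y                  ≈⟨ *-identityˡ y ⟩
    y                       ∎

  *≈0⇒≈0 : ∀ x y → x ≉ 0# → x * y ≈ 0# → y ≈ 0#
  *≈0⇒≈0 x y x≉0 xy≈0 = *-cancelˡ x y 0# x≉0 (trans xy≈0 (sym (zeroʳ x)))

  *≈self⇒≈1 : ∀ a x → a ≉ 0# → a * x ≈ a → x ≈ 1#
  *≈self⇒≈1 a x a≉0 ax≈a = *-cancelˡ a x 1# a≉0 (trans ax≈a (sym (*-identityʳ a)))

  *-≉0 : ∀ x y → x ≉ 0# → y ≉ 0# → x * y ≉ 0#
  *-≉0 x y x≉0 y≉0 xy≈0 = y≉0 (*≈0⇒≈0 x y x≉0 xy≈0)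

  ^-≉0 : ∀ x n → x ≉ 0# → x ^ n ≉ 0#
  ^-≉0 x zero    x≉0 = 1≉0
  ^-≉0 x (suc n) x≉0 = *-≉0 x (x ^ n) x≉0 (^-≉0 x n x≉0)

  ∏-≉0 : ∀ {n} (v : Fin n → F) → (∀ i → v i ≉ 0#) → ∏.sum v ≉ 0#
  ∏-≉0 {zero}  v v≉0 = 1≉0
  ∏-≉0 {suc n} v v≉0 = *-≉0 _ _ (v≉0 Fin.zero) (∏-≉0 (λ i → v (Fin.suc i)) (λ i → v≉0 (Fin.suc i)))

  x*[x⁻¹*y]≈y : ∀ x (x≉0 : x ≉ 0#) y → x * (x ⁻¹⟨ x≉0 ⟩ * y) ≈ y
  x*[x⁻¹*y]≈y x x≉0 y = begin
    x * (x ⁻¹⟨ x≉0 ⟩ * y)  ≈⟨ *-assoc _ _ _ ⟨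
    (x * x ⁻¹⟨ x≉0 ⟩) * y  ≈⟨ *-congʳ (*-inverseʳ x x≉0) ⟩
    1# * y                 ≈⟨ *-identityˡ y ⟩
    y                      ∎

  module _ (_≈?_ : Decidable _≈_) where

    zero-product : ∀ x y → x * y ≈ 0# → x ≈ 0# ⊎ y ≈ 0#
    zero-product x y xy≈0 with x ≈? 0#
    ... | yes x≈0 = inj₁ x≈0
    ... | no x≉0  = inj₂ (*≈0⇒≈0 x y x≉0 xy≈0)

    ^≈0⇒≈0 : ∀ x n → x ^ suc n ≈ 0# → x ≈ 0#
    ^≈0⇒≈0 x zero    x¹≈0 = trans (sym (*-identityʳ x)) x¹≈0
    ^≈0⇒≈0 x (suc n) xⁿ⁺²≈0 = [ id , ^≈0⇒≈0 x n ]′ (zero-product x _ xⁿ⁺²≈0)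

    -- S = x² + x + 1 satisfies S x ≈ S, so S ≉ 0 would force x ≈ 1.
    x^3≈1∧x≉1⇒x*x+x+1≈0 : ∀ x → x ^ 3 ≈ 1# → x ≉ 1# → x * x + x + 1# ≈ 0#
    x^3≈1∧x≉1⇒x*x+x+1≈0 x x³≈1 x≉1 with (x * x + x + 1#) ≈? 0#
    ... | yes S≈0 = S≈0
    ... | no S≉0  = ⊥-elim (x≉1 (*≈self⇒≈1 _ x S≉0 (begin
      (x * x + x + 1#) * x    ≈⟨ solve 1 (λ x → (x :* x :+ x :+ con 1) :* x := x :^ 3 :+ (x :* x :+ x)) refl x ⟩
      x ^ 3 + (x * x + x)     ≈⟨ +-congʳ x³≈1 ⟩
      1# + (x * x + x)        ≈⟨ solve 1 (λ x → con 1 :+ (x :* x :+ x) := x :* x :+ x :+ con 1) refl x ⟩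
      x * x + x + 1#          ∎)))

module FiniteField {c ℓ} (K : CommutativeRing c ℓ) (isField : FieldDefs.IsField K)
  {N : ℕ} (card : FieldDefs.HasCard K N) where
  open CommutativeRing K renaming (Carrier to F)
  open Inverse card using (to; from; to-cong; inverseˡ; inverseʳ)
  open Field K isField
  open CommutativeRingProperties K using (∏-constant-but-one)
  open import Algebra.Properties.Semiring.Exp semiring using (_^_)
  open import Algebra.Properties.Semiring.Mult semiring using (_×_)
  open import Algebra.Properties.RingWithoutOne (Ring.ringWithoutOne ring) using (+-cancelʳ)
  open import Relation.Binary.Reasoning.Setoid setoid
  module ∑ = CommutativeMonoidSum +-commutativeMonoid

  from-to : ∀ x → from (to x) ≈ x
  from-to x = inverseʳ ≡.refl

  to-from : ∀ i → to (from i) ≡ i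
  to-from i = inverseˡ refl

  to-injective : ∀ {x y} → to x ≡ to y → x ≈ y
  to-injective {x} {y} tx≡ty = trans (sym (from-to x)) (trans (reflexive (≡.cong from tx≡ty)) (from-to y))

  _≈?_ : Decidable _≈_
  x ≈? y with to x Fin.≟ to y
  ... | yes tx≡ty = yes (to-injective tx≡ty)
  ... | no tx≢ty  = no (λ x≈y → tx≢ty (to-cong x≈y))

  permutationOf : (φ ψ : F → F) → (∀ {x y} → x ≈ y → φ x ≈ φ y) → (∀ {x y} → x ≈ y → ψ x ≈ ψ y) →
    (∀ x → φ (ψ x) ≈ x) → (∀ x → ψ (φ x) ≈ x) → Permutation N N
  permutationOf φ ψ φ-cong ψ-cong φψ≈id ψφ≈id = permutation (λ i → to (φ (from i))) (λ i → to (ψ (from i))) φψ ψφ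
    where
    φψ : ∀ i → to (φ (from (to (ψ (from i))))) ≡ i
    φψ i = ≡.trans (to-cong (φ-cong (from-to _))) (≡.trans (to-cong (φψ≈id (from i))) (to-from i))
    ψφ : ∀ i → to (ψ (from (to (φ (from i))))) ≡ i
    ψφ i = ≡.trans (to-cong (ψ-cong (from-to _))) (≡.trans (to-cong (ψφ≈id (from i))) (to-from i))

  -- Translation by 1 permutes the elements, so their sum S satisfies S ≈ N·1 + S.
  N×1≈0 : N × 1# ≈ 0#
  N×1≈0 = sym (+-cancelʳ S 0# (N × 1#) (begin
      0# + S                                  ≈⟨ +-identityˡ S ⟩
      S                                       ≈⟨ ∑.sum-permute from translation ⟩
      ∑.sum (λ i → from (to (1# + from i)))  ≈⟨ ∑.sum-cong-≋ (λ i → from-to (1# + from i)) ⟩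
      ∑.sum (λ i → 1# + from i)              ≈⟨ ∑.∑-distrib-+ (replicate N 1#) from ⟩
      ∑.sum (replicate N 1#) + S             ≈⟨ +-congʳ (∑.sum-replicate N) ⟩
      N × 1# + S                              ∎))
    where
    S : F
    S = ∑.sum from
    translation : Permutation N N
    translation = permutationOf (1# +_) (- 1# +_) +-congˡ +-congˡ
      (λ x → trans (sym (+-assoc _ _ _)) (trans (+-congʳ (-‿inverseʳ 1#)) (+-identityˡ x)))
      (λ x → trans (sym (+-assoc _ _ _)) (trans (+-congʳ (-‿inverseˡ 1#)) (+-identityˡ x)))

  -- Lagrange for the multiplicative group, with 0 replaced by 1 so that the product P of all
  -- (replaced) elements is nonzero: scaling by x permutes the elements and turns P into x^(N-1) P.
  fermat : ∀ x → x ≉ 0# → x ^ (N ∸ 1) ≈ 1#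
  fermat x x≉0 = *-cancelˡ P _ _ (∏-≉0 (λ i → unit (from i)) (λ i → unit-≉0 _)) (begin
      P * x ^ (N ∸ 1)                                ≈⟨ *-comm _ _ ⟩
      x ^ (N ∸ 1) * P                                ≈⟨ *-congʳ ∏-scale ⟨
      ∏.sum (λ i → scale (from i)) * P               ≈⟨ ∏.∑-distrib-+ (λ i → scale (from i)) (λ i → unit (from i)) ⟨
      ∏.sum (λ i → scale (from i) * unit (from i))   ≈⟨ ∏.sum-cong-≋ (λ i → unit-* (from i)) ⟨
      ∏.sum (λ i → unit (x * from i))                ≈⟨ ∏.sum-cong-≋ (λ i → unit-cong (from-to (x * from i))) ⟨
      ∏.sum (λ i → unit (from (to (x * from i))))    ≈⟨ ∏.sum-permute (λ i → unit (from i)) dilation ⟨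
      P                                              ≈⟨ *-identityʳ P ⟨
      P * 1#                                         ∎)
    where
    unit : F → F
    unit y with y ≈? 0#
    ... | yes _ = 1#
    ... | no _  = y

    unit-cong : ∀ {y z} → y ≈ z → unit y ≈ unit z
    unit-cong {y} {z} y≈z with y ≈? 0# | z ≈? 0#
    ... | yes _   | yes _   = refl
    ... | no _    | no _    = y≈z
    ... | yes y≈0 | no z≉0  = ⊥-elim (z≉0 (trans (sym y≈z) y≈0))
    ... | no y≉0  | yes z≈0 = ⊥-elim (y≉0 (trans y≈z z≈0))

    unit-≉0 : ∀ y → unit y ≉ 0#
    unit-≉0 y with y ≈? 0#
    ... | yes _   = 1≉0
    ... | no y≉0  = y≉0

    scale : F → F
    scale y with y ≈? 0#
    ... | yes _ = 1#
    ... | no _  = x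

    unit-* : ∀ y → unit (x * y) ≈ scale y * unit y
    unit-* y with y ≈? 0# | (x * y) ≈? 0#
    ... | yes _   | yes _    = sym (*-identityˡ 1#)
    ... | no _    | no _     = refl
    ... | yes y≈0 | no xy≉0  = ⊥-elim (xy≉0 (trans (*-congˡ y≈0) (zeroʳ x)))
    ... | no y≉0  | yes xy≈0 = ⊥-elim (*-≉0 x y x≉0 y≉0 xy≈0)

    P : F
    P = ∏.sum (λ i → unit (from i))

    dilation : Permutation N N
    dilation = permutationOf (x *_) (x ⁻¹⟨ x≉0 ⟩ *_) *-congˡ *-congˡ
      (x*[x⁻¹*y]≈y x x≉0)
      (λ y → trans (sym (*-assoc _ _ _)) (trans (*-congʳ (*-inverseˡ x x≉0)) (*-identityˡ y)))

    ∏-scale : ∏.sum (λ i → scale (from i)) ≈ x ^ (N ∸ 1)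
    ∏-scale = ∏-constant-but-one (λ i → scale (from i)) (to 0#) x scale-at-0 scale-elsewhere
      where
      scale-at-0 : scale (from (to 0#)) ≈ 1#
      scale-at-0 with from (to 0#) ≈? 0#
      ... | yes _ = refl
      ... | no ≉0 = ⊥-elim (≉0 (from-to 0#))
      scale-elsewhere : ∀ i → i ≢ to 0# → scale (from i) ≈ x
      scale-elsewhere i i≢0 with from i ≈? 0#
      ... | yes ≈0 = ⊥-elim (i≢0 (≡.trans (≡.sym (to-from i)) (to-cong ≈0)))
      ... | no _   = refl

module Frobenius {c ℓ} (K : CommutativeRing c ℓ) {p : ℕ} (p-prime : Prime p) where
  open CommutativeRing K renaming (Carrier to F)
  open import Algebra.Properties.Semiring.Mult semiring using (_×_)
  open import Algebra.Properties.Semiring.Exp semiring using (_^_; ^-congˡ; ^-assocʳ)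
  open import Algebra.Properties.Semiring.Sum semiring using (sum; sum-init-last; sum-cong-≋; sum-replicate-zero)
  open import Algebra.Properties.CommutativeSemiring.Binomial commutativeSemiring
    using (theorem; binomial; binomialTerm)
  open CommutativeRingProperties K using (∣∧×1≈0⇒×≈0)
  open import Relation.Binary.Reasoning.Setoid setoid

  module _ (p×1≈0 : p × 1# ≈ 0#) where

    -- The binomial coefficients p C k with 0 < k < p vanish, leaving the two end terms.
    frobenius : ∀ x y → (x + y) ^ p ≈ x ^ p + y ^ p
    frobenius with ≥2⇒≡2+ (prime⇒2≤ p-prime)
    ... | m , p≡2+m = expand m p≡2+m
      where
      expand : ∀ m → p ≡ suc (suc m) → ∀ x y → (x + y) ^ p ≈ x ^ p + y ^ p
      expand m ≡.refl x y = begin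
        (x + y) ^ p                                         ≈⟨ theorem p x y ⟩
        sum t                                               ≈⟨ +-congˡ (sum-init-last (tail t)) ⟩
        t Fin.zero + (sum (init (tail t)) + last (tail t))  ≈⟨ +-cong first (+-cong middle final) ⟩
        y ^ p + (0# + x ^ p)                                ≈⟨ +-congˡ (+-identityˡ _) ⟩
        y ^ p + x ^ p                                       ≈⟨ +-comm _ _ ⟩
        x ^ p + y ^ p                                       ∎
        where
        t : Fin (suc p) → F
        t = binomialTerm x y p
        first : t Fin.zero ≈ y ^ p
        first = trans (+-identityʳ _) (*-identityˡ _)
        middle : sum (init (tail t)) ≈ 0#
        middle = trans (sum-cong-≋ (λ i → ∣∧×1≈0⇒×≈0 (p∣C i) p×1≈0 (binomial x y p (Fin.suc (inject₁ i)))))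
                       (sum-replicate-zero (suc m))
          where
          p∣C : ∀ (i : Fin (suc m)) → p ∣ p C suc (toℕ (inject₁ i))
          p∣C i = prime∣C p-prime _ (s≤s z≤n)
            (s≤s (≡.subst (_< suc m) (≡.sym (Fin.toℕ-inject₁ i)) (Fin.toℕ<n i)))
        final : last (tail t) ≈ x ^ p
        final rewrite Fin.toℕ-fromℕ m | nCn≡1 (suc (suc m)) | ℕ.n∸n≡0 m =
          trans (+-identityʳ _) (*-identityʳ _)

    frobenius-^ : ∀ r x y → (x + y) ^ (p ℕ.^ r) ≈ x ^ (p ℕ.^ r) + y ^ (p ℕ.^ r)
    frobenius-^ zero    x y = trans (*-identityʳ _) (sym (+-cong (*-identityʳ x) (*-identityʳ y)))
    frobenius-^ (suc r) x y = begin
      (x + y) ^ (p ℕ.* p ℕ.^ r)                  ≈⟨ ^-assocʳ _ p (p ℕ.^ r) ⟨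
      ((x + y) ^ p) ^ (p ℕ.^ r)                  ≈⟨ ^-congˡ (p ℕ.^ r) (frobenius x y) ⟩
      (x ^ p + y ^ p) ^ (p ℕ.^ r)                ≈⟨ frobenius-^ r _ _ ⟩
      (x ^ p) ^ (p ℕ.^ r) + (y ^ p) ^ (p ℕ.^ r)  ≈⟨ +-cong (^-assocʳ x p _) (^-assocʳ y p _) ⟩
      x ^ (p ℕ.* p ℕ.^ r) + y ^ (p ℕ.* p ℕ.^ r)  ∎

module Curve {c ℓ} (K : CommutativeRing c ℓ) (isField : FieldDefs.IsField K)
  (_≈?_ : Decidable (CommutativeRing._≈_ K)) (m : ℕ) where
  open CommutativeRing K renaming (Carrier to F)
  open FieldDefs K
  open Field K isField
  open CommutativeRingProperties K
  open import Algebra.Properties.Semiring.Exp semiring using (_^_; ^-congˡ; ^-assocʳ)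
  open import Algebra.Properties.CommutativeSemiring.Exp commutativeSemiring using (^-distrib-*)
  open import Algebra.Properties.Ring ring using (-‿distribʳ-*)
  open import Algebra.Properties.Group +-group using (inverseʳ-unique)
  open import Algebra.Solver.Ring.NaturalCoefficients.Default commutativeSemiring
  open import Data.Product using (_×_)
  open import Relation.Binary.Reasoning.Setoid setoid

  q Q : ℕ
  q = suc (suc m)
  Q = suc m

  Classification : F → F → F → Set (c ⊔ ℓ)
  Classification u v w =
    ((q % 3 ≡ 2) × Form1 q u v w) ⊎ ((q % 3 ≡ 0) × Form2 q u v w) ⊎ Form3 q u v w

  ^Q≈1⇒∈Fq : ∀ a → a ^ Q ≈ 1# → InFq q a
  ^Q≈1⇒∈Fq a a^Q≈1 = trans (*-congˡ a^Q≈1) (*-identityʳ a)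

  ∈Fq*⇒^Q≈1 : ∀ a → InFq* q a → a ^ Q ≈ 1#
  ∈Fq*⇒^Q≈1 a (aᵠ≈a , a≉0) = *≈self⇒≈1 a (a ^ Q) a≉0 aᵠ≈a

  ≈0⇒^Q≈0 : ∀ x → x ≈ 0# → x ^ Q ≈ 0#
  ≈0⇒^Q≈0 x x≈0 = trans (^-congˡ Q x≈0) (zeroˡ _)

  onCurve-scale : ∀ {u v w a b e} → OnCurve q a b e → SamePoint u v w a b e → OnCurve q u v w
  onCurve-scale {u} {v} {w} {a} {b} {e} onCurve (t , _ , u≈ta , v≈tb , w≈te) = begin
    u ^ Q + v ^ Q + w ^ Q               ≈⟨ +-cong (+-cong (power u≈ta) (power v≈tb)) (power w≈te) ⟩
    T * a ^ Q + T * b ^ Q + T * e ^ Q   ≈⟨ solve 4 (λ T a b e → T :* a :+ T :* b :+ T :* e := T :* (a :+ b :+ e)) refl T (a ^ Q) (b ^ Q) (e ^ Q) ⟩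
    T * (a ^ Q + b ^ Q + e ^ Q)         ≈⟨ *-congˡ onCurve ⟩
    T * 0#                              ≈⟨ zeroʳ T ⟩
    0#                                  ∎
    where
    T : F
    T = t ^ Q
    power : ∀ {x y} → x ≈ t * y → x ^ Q ≈ T * y ^ Q
    power x≈ty = trans (^-congˡ Q x≈ty) (^-distrib-* t _ Q)

  onCurve-swapˡ : ∀ {u v w} → OnCurve q u v w → OnCurve q v u w
  onCurve-swapˡ onCurve = trans (+-congʳ (+-comm _ _)) onCurve

  onCurve-swapʳ : ∀ {u v w} → OnCurve q u v w → OnCurve q u w v
  onCurve-swapʳ {u} {v} {w} onCurve =
    trans (solve 3 (λ u v w → u :+ w :+ v := u :+ v :+ w) refl (u ^ Q) (v ^ Q) (w ^ Q)) onCurve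

  onCurve-zeroˡ : ∀ {u v w} → u ≈ 0# → OnCurve q u v w → v ^ Q + w ^ Q ≈ 0#
  onCurve-zeroˡ {u} u≈0 onCurve =
    trans (sym (+-congʳ (trans (+-congʳ (≈0⇒^Q≈0 u u≈0)) (+-identityˡ _)))) onCurve

  onCurve-Form1 : ∀ a y → InFq* q a → PrimitiveCubeRoot (y ^ Q) → OnCurve q (a * (y * y)) y 1#
  onCurve-Form1 a y a∈Fq* (ω³≈1 , ω≉1) = begin
    (a * (y * y)) ^ Q + ω + 1# ^ Q    ≈⟨ +-cong (+-congʳ first) (1^n≈1 Q) ⟩
    ω * ω + ω + 1#                    ≈⟨ x^3≈1∧x≉1⇒x*x+x+1≈0 _≈?_ ω ω³≈1 ω≉1 ⟩
    0#                                ∎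
    where
    ω : F
    ω = y ^ Q
    first : (a * (y * y)) ^ Q ≈ ω * ω
    first = begin
      (a * (y * y)) ^ Q      ≈⟨ ^-distrib-* a _ Q ⟩
      a ^ Q * (y * y) ^ Q    ≈⟨ *-cong (∈Fq*⇒^Q≈1 a a∈Fq*) (^-distrib-* y y Q) ⟩
      1# * (ω * ω)           ≈⟨ *-identityˡ _ ⟩
      ω * ω                  ∎

  onCurve-Form2 : ∀ a b → 1# + 1# + 1# ≈ 0# → InFq* q a → InFq* q b → OnCurve q a b 1#
  onCurve-Form2 a b 3≈0 a∈Fq* b∈Fq* =
    trans (+-cong (+-cong (∈Fq*⇒^Q≈1 a a∈Fq*) (∈Fq*⇒^Q≈1 b b∈Fq*)) (1^n≈1 Q)) 3≈0

  onCurve-Form3 : ∀ d → d ^ Q ≈ - 1# → OnCurve q 0# 1# d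
  onCurve-Form3 d d^Q≈-1 = begin
    0# ^ Q + 1# ^ Q + d ^ Q  ≈⟨ +-cong (+-cong (≈0⇒^Q≈0 0# refl) (1^n≈1 Q)) d^Q≈-1 ⟩
    0# + 1# + - 1#           ≈⟨ +-congʳ (+-identityˡ 1#) ⟩
    1# + - 1#                ≈⟨ -‿inverseʳ 1# ⟩
    0#                       ∎

  Form3⇒onCurve : ∀ {u v w} → Form3 q u v w → OnCurve q u v w
  Form3⇒onCurve (d , d^Q≈-1 , point) =
    [ onCurve-scale on-01d , [ onCurve-scale on-0d1 , [ onCurve-scale on-10d
    , [ onCurve-scale on-1d0 , [ onCurve-scale on-d01 , onCurve-scale on-d10 ]′ ]′ ]′ ]′ ]′ point
    where
    on-01d : OnCurve q 0# 1# d
    on-01d = onCurve-Form3 d d^Q≈-1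
    on-0d1 : OnCurve q 0# d 1#
    on-0d1 = onCurve-swapʳ on-01d
    on-10d : OnCurve q 1# 0# d
    on-10d = onCurve-swapˡ on-01d
    on-1d0 : OnCurve q 1# d 0#
    on-1d0 = onCurve-swapʳ on-10d
    on-d01 : OnCurve q d 0# 1#
    on-d01 = onCurve-swapˡ on-0d1
    on-d10 : OnCurve q d 1# 0#
    on-d10 = onCurve-swapʳ on-d01

  classification⇒onCurve : (q % 3 ≡ 0 → 1# + 1# + 1# ≈ 0#) →
    ∀ {u v w} → Classification u v w → OnCurve q u v w
  classification⇒onCurve _ (inj₁ (_ , a , y , a∈Fq* , ω , point)) =
    onCurve-scale (onCurve-Form1 a y a∈Fq* ω) point
  classification⇒onCurve q%3≡0⇒3≈0 (inj₂ (inj₁ (q%3≡0 , a , b , a∈Fq* , b∈Fq* , point))) =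
    onCurve-scale (onCurve-Form2 a b (q%3≡0⇒3≈0 q%3≡0) a∈Fq* b∈Fq*) point
  classification⇒onCurve _ (inj₂ (inj₂ form3)) = Form3⇒onCurve form3

  two-term-ratio : ∀ a b → a ≉ 0# → a ^ Q + b ^ Q ≈ 0# → ∃ λ d → (d ^ Q ≈ - 1#) × (b ≈ a * d)
  two-term-ratio a b a≉0 a^Q+b^Q≈0 = d , d^Q≈-1 , sym (x*[x⁻¹*y]≈y a a≉0 b)
    where
    d : F
    d = a ⁻¹⟨ a≉0 ⟩ * b
    d^Q≈-1 : d ^ Q ≈ - 1#
    d^Q≈-1 = *-cancelˡ (a ^ Q) _ _ (^-≉0 a Q a≉0) (begin
      a ^ Q * d ^ Q   ≈⟨ ^-distrib-* a d Q ⟨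
      (a * d) ^ Q     ≈⟨ ^-congˡ Q (x*[x⁻¹*y]≈y a a≉0 b) ⟩
      b ^ Q           ≈⟨ inverseʳ-unique _ _ a^Q+b^Q≈0 ⟩
      - (a ^ Q)       ≈⟨ -‿cong (*-identityʳ _) ⟨
      - (a ^ Q * 1#)  ≈⟨ -‿distribʳ-* _ _ ⟩
      a ^ Q * - 1#    ∎)

  ≈0⇒≈*0 : ∀ t {x} → x ≈ 0# → x ≈ t * 0#
  ≈0⇒≈*0 t x≈0 = trans x≈0 (sym (zeroʳ t))

  ≈*1 : ∀ t → t ≈ t * 1#
  ≈*1 t = sym (*-identityʳ t)

  module _ (fermat : ∀ z → z ≉ 0# → z ^ (q ℕ.* q ∸ 1) ≈ 1#)
           (frobenius : ∀ x y → (x + y) ^ q ≈ x ^ q + y ^ q)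
           (3≈0⇔q%3≡0 : (1# + 1# + 1# ≈ 0#) ⇔ (q % 3 ≡ 0)) where

    norm≈1 : ∀ z → z ≉ 0# → z ^ Q * (z ^ Q) ^ q ≈ 1#
    norm≈1 z z≉0 = begin
      (z ^ Q) ^ suc q    ≈⟨ ^-assocʳ z Q (suc q) ⟩
      z ^ (Q ℕ.* suc q)  ≡⟨ ≡.cong (z ^_) (ℕ.*-suc Q q) ⟩
      z ^ (q ℕ.* q ∸ 1)  ≈⟨ fermat z z≉0 ⟩
      1#                 ∎

    frobenius-line : ∀ x y → x + y + 1# ≈ 0# → x ^ q + y ^ q + 1# ≈ 0#
    frobenius-line x y x+y+1≈0 = begin
      x ^ q + y ^ q + 1#      ≈⟨ +-congˡ (1^n≈1 q) ⟨
      x ^ q + y ^ q + 1# ^ q  ≈⟨ +-congʳ (frobenius x y) ⟨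
      (x + y) ^ q + 1# ^ q    ≈⟨ frobenius (x + y) 1# ⟨
      (x + y + 1#) ^ q        ≈⟨ ^-congˡ q x+y+1≈0 ⟩
      0# ^ q                  ≈⟨ zeroˡ _ ⟩
      0#                      ∎

    module _ {u v w} a b (w≉0 : w ≉ 0#) (a≉0 : a ≉ 0#) (b≉0 : b ≉ 0#)
             (u≈wa : u ≈ w * a) (v≈wb : v ≈ w * b) (line : a ^ Q + b ^ Q + 1# ≈ 0#) where

      α β : F
      α = a ^ Q
      β = b ^ Q

      αβ≈1 : α * β ≈ 1#
      αβ≈1 = x+y≈x⁻¹+y⁻¹⇒x*y≈1 α β (α ^ q) (β ^ q) line (frobenius-line α β line)
               (norm≈1 a a≉0) (norm≈1 b b≉0)

      α³≈1 : α ^ 3 ≈ 1#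
      α³≈1 = x*x+x+1≈0⇒x^3≈1 α (x+y+1≈0⇒x*x+x+1≈0 α β line αβ≈1)

      affine-Form2 : α ≈ 1# → (q % 3 ≡ 0) × Form2 q u v w
      affine-Form2 α≈1 = Equivalence.to 3≈0⇔q%3≡0 3≈0
        , a , b , (^Q≈1⇒∈Fq a α≈1 , a≉0) , (^Q≈1⇒∈Fq b β≈1 , b≉0) , w , w≉0 , u≈wa , v≈wb , ≈*1 w
        where
        β≈1 : β ≈ 1#
        β≈1 = trans (sym (*-identityˡ β)) (trans (*-congʳ (sym α≈1)) αβ≈1)
        3≈0 : 1# + 1# + 1# ≈ 0#
        3≈0 = trans (+-congʳ (+-cong (sym α≈1) (sym β≈1))) line

      -- Here β is a primitive cube root with β² ≈ α, so γ = a / b² has γ^(q-1) ≈ α / β² ≈ 1.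
      affine-Form1 : α ≉ 1# → (q % 3 ≡ 2) × Form1 q u v w
      affine-Form1 α≉1 = x^3≈1∧x*x^n≈1⇒n%3≡2 α q α³≈1 α≉1 (norm≈1 a a≉0)
        , γ , b , (^Q≈1⇒∈Fq γ γ^Q≈1 , γ≉0) , (x^3≈1∧x*y≈1⇒y^3≈1 α β α³≈1 αβ≈1 , β≉1)
        , w , w≉0 , trans u≈wa (*-congˡ (sym γb²≈a)) , v≈wb , ≈*1 w
        where
        β≉1 : β ≉ 1#
        β≉1 β≈1 = α≉1 (trans (sym (*-identityʳ α)) (trans (*-congˡ (sym β≈1)) αβ≈1))
        b²≉0 : b * b ≉ 0#
        b²≉0 = *-≉0 b b b≉0 b≉0
        γ : F
        γ = (b * b) ⁻¹⟨ b²≉0 ⟩ * a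
        γb²≈a : γ * (b * b) ≈ a
        γb²≈a = trans (*-comm _ _) (x*[x⁻¹*y]≈y (b * b) b²≉0 a)
        γ≉0 : γ ≉ 0#
        γ≉0 = *-≉0 _ a (⁻¹-≉0 (b * b) b²≉0) a≉0
        γ^Q≈1 : γ ^ Q ≈ 1#
        γ^Q≈1 = *≈self⇒≈1 (β * β) (γ ^ Q) (*-≉0 β β (^-≉0 b Q b≉0) (^-≉0 b Q b≉0)) (begin
          β * β * γ ^ Q          ≈⟨ *-comm _ _ ⟩
          γ ^ Q * (β * β)        ≈⟨ *-congˡ (^-distrib-* b b Q) ⟨
          γ ^ Q * (b * b) ^ Q    ≈⟨ ^-distrib-* γ (b * b) Q ⟨
          (γ * (b * b)) ^ Q      ≈⟨ ^-congˡ Q γb²≈a ⟩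
          α                      ≈⟨ x^3≈1∧x*y≈1⇒y*y≈x α β α³≈1 αβ≈1 ⟨
          β * β                  ∎)

      affine-classification : Classification u v w
      affine-classification with α ≈? 1#
      ... | yes α≈1 = inj₂ (inj₁ (affine-Form2 α≈1))
      ... | no α≉1  = inj₁ (affine-Form1 α≉1)

    generic-classification : ∀ {u v w} → u ≉ 0# → v ≉ 0# → w ≉ 0# → OnCurve q u v w → Classification u v w
    generic-classification {u} {v} {w} u≉0 v≉0 w≉0 onCurve =
      affine-classification a b w≉0 (*-≉0 _ u w⁻¹≉0 u≉0) (*-≉0 _ v w⁻¹≉0 v≉0)
        (sym (x*[x⁻¹*y]≈y w w≉0 u)) (sym (x*[x⁻¹*y]≈y w w≉0 v))
        (trans (+-congˡ (sym (1^n≈1 Q))) (onCurve-scale onCurve (w ⁻¹⟨ w≉0 ⟩ , w⁻¹≉0 , refl , refl , sym (*-inverseˡ w w≉0))))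
      where
      w⁻¹≉0 : w ⁻¹⟨ w≉0 ⟩ ≉ 0#
      w⁻¹≉0 = ⁻¹-≉0 w w≉0
      a b : F
      a = w ⁻¹⟨ w≉0 ⟩ * u
      b = w ⁻¹⟨ w≉0 ⟩ * v

    onCurve⇒classification : ∀ {u v w} → NonZeroTriple u v w → OnCurve q u v w → Classification u v w
    onCurve⇒classification {u} {v} {w} nonzero onCurve with u ≈? 0# | v ≈? 0# | w ≈? 0#
    ... | yes u≈0 | yes v≈0 | _ = ⊥-elim (nonzero (u≈0 , v≈0 , ^≈0⇒≈0 _≈?_ w m w^Q≈0))
      where
      w^Q≈0 : w ^ Q ≈ 0#
      w^Q≈0 = trans (sym (trans (+-congʳ (≈0⇒^Q≈0 v v≈0)) (+-identityˡ _))) (onCurve-zeroˡ u≈0 onCurve)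
    ... | yes u≈0 | no v≉0 | _ with two-term-ratio v w v≉0 (onCurve-zeroˡ u≈0 onCurve)
    ...   | d , d^Q≈-1 , w≈vd = inj₂ (inj₂ (d , d^Q≈-1 , inj₁ (v , v≉0 , ≈0⇒≈*0 v u≈0 , ≈*1 v , w≈vd)))
    onCurve⇒classification {u} {v} {w} nonzero onCurve | no u≉0 | yes v≈0 | _
      with two-term-ratio u w u≉0 (onCurve-zeroˡ v≈0 (onCurve-swapˡ onCurve))
    ...   | d , d^Q≈-1 , w≈ud =
      inj₂ (inj₂ (d , d^Q≈-1 , inj₂ (inj₂ (inj₁ (u , u≉0 , ≈*1 u , ≈0⇒≈*0 u v≈0 , w≈ud)))))
    onCurve⇒classification {u} {v} {w} nonzero onCurve | no u≉0 | no v≉0 | yes w≈0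
      with two-term-ratio u v u≉0 (onCurve-zeroˡ w≈0 (onCurve-swapˡ (onCurve-swapʳ onCurve)))
    ...   | d , d^Q≈-1 , v≈ud =
      inj₂ (inj₂ (d , d^Q≈-1 , inj₂ (inj₂ (inj₂ (inj₁ (u , u≉0 , ≈*1 u , v≈ud , ≈0⇒≈*0 u w≈0))))))
    onCurve⇒classification nonzero onCurve | no u≉0 | no v≉0 | no w≉0 =
      generic-classification u≉0 v≉0 w≉0 onCurve

    classification : ∀ {u v w} → NonZeroTriple u v w → OnCurve q u v w ⇔ Classification u v w
    classification nonzero =
      mk⇔ (onCurve⇒classification nonzero) (classification⇒onCurve (Equivalence.from 3≈0⇔q%3≡0))

module PrimePowerField {c ℓ} (K : CommutativeRing c ℓ) (isField : FieldDefs.IsField K)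
  {p r q : ℕ} (p-prime : Prime p) (q≡p^r : q ≡ p ℕ.^ suc r) (card : FieldDefs.HasCard K (q ℕ.* q)) where
  open CommutativeRing K
  open Field K isField
  open FiniteField K isField card public using (_≈?_; fermat)
  open FiniteField K isField card using (N×1≈0)
  open CommutativeRingProperties K using (×1-homo-^; %-×1≈0)
  open Frobenius K p-prime using (frobenius-^)
  open import Algebra.Properties.Semiring.Exp semiring using (_^_)
  open import Algebra.Properties.Semiring.Mult semiring using (_×_; ×1-homo-*)

  p×1≈0 : p × 1# ≈ 0#
  p×1≈0 = ^≈0⇒≈0 _≈?_ (p × 1#) r (trans (sym (×1-homo-^ p (suc r))) (≡.subst (λ n → n × 1# ≈ 0#) q≡p^r q×1≈0))
    where
    q×1≈0 : q × 1# ≈ 0#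
    q×1≈0 = reduce (zero-product _≈?_ _ _ (trans (sym (×1-homo-* q q)) N×1≈0))

  frobenius-q : ∀ x y → (x + y) ^ q ≈ x ^ q + y ^ q
  frobenius-q x y = ≡.subst (λ n → (x + y) ^ n ≈ x ^ n + y ^ n) (≡.sym q≡p^r) (frobenius-^ p×1≈0 (suc r) x y)

  -- If 3 = 0 then (p mod 3)·1 = 0 too, and reducing 3 mod 2 rules out p mod 3 = 2 as well.
  3×1≈0⇒p≡3 : 3 × 1# ≈ 0# → p ≡ 3
  3×1≈0⇒p≡3 3×1≈0 with %3-cases p | %-×1≈0 p 3 p×1≈0 3×1≈0
  ... | inj₁ p%3≡0 | _ = ≡.sym (∣prime⇒≡ p-prime (m%n≡0⇒n∣m p 3 p%3≡0) (λ ()))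
  ... | inj₂ (inj₁ p%3≡1) | [p%3]×1≈0 =
    ⊥-elim (1≉0 (trans (sym (+-identityʳ 1#)) (≡.subst (λ n → n × 1# ≈ 0#) p%3≡1 [p%3]×1≈0)))
  ... | inj₂ (inj₂ p%3≡2) | [p%3]×1≈0 = ⊥-elim (1≉0 (trans (sym (+-identityʳ 1#))
    (%-×1≈0 3 2 3×1≈0 (≡.subst (λ n → n × 1# ≈ 0#) p%3≡2 [p%3]×1≈0))))

  p≡3⇒q%3≡0 : p ≡ 3 → q % 3 ≡ 0
  p≡3⇒q%3≡0 ≡.refl = n∣m⇒m%n≡0 q 3 (≡.subst (3 ∣_) (≡.sym q≡p^r) (m∣m*n (3 ℕ.^ r)))

  q%3≡0⇒p≡3 : q % 3 ≡ 0 → p ≡ 3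
  q%3≡0⇒p≡3 q%3≡0 = ≡.sym (∣prime⇒≡ p-prime
    (prime∣^⇒∣ (from-yes (prime? 3)) p (suc r) (≡.subst (3 ∣_) q≡p^r (m%n≡0⇒n∣m q 3 q%3≡0))) (λ ()))

  3≈0⇔q%3≡0 : (1# + 1# + 1# ≈ 0#) ⇔ (q % 3 ≡ 0)
  3≈0⇔q%3≡0 = mk⇔
    (λ 3≈0 → p≡3⇒q%3≡0 (3×1≈0⇒p≡3 (trans 3×1≈1+1+1 3≈0)))
    (λ q%3≡0 → trans (sym 3×1≈1+1+1) (≡.subst (λ n → n × 1# ≈ 0#) (q%3≡0⇒p≡3 q%3≡0) p×1≈0))
    where
    3×1≈1+1+1 : 3 × 1# ≈ 1# + 1# + 1#
    3×1≈1+1+1 = trans (+-congˡ (+-congˡ (+-identityʳ 1#))) (sym (+-assoc 1# 1# 1#))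

open import Data.Nat using (_^_; _*_)
open import Data.Product using (_×_)

theorem3 : ∀ {c ℓ} (p r q : ℕ) → Prime p → 1 ≤ r → q ≡ p ^ r →
    (K : CommutativeRing c ℓ) → FieldDefs.IsField K → FieldDefs.HasCard K (q * q) →
    ∀ u v w → FieldDefs.NonZeroTriple K u v w →
    (FieldDefs.OnCurve K q u v w ⇔
      (((q % 3 ≡ 2) × FieldDefs.Form1 K q u v w)
      ⊎ ((q % 3 ≡ 0) × FieldDefs.Form2 K q u v w)
      ⊎ FieldDefs.Form3 K q u v w))
theorem3 p (suc r) q p-prime (s≤s z≤n) q≡p^r K isField card u v w nonzero
  with ≥2⇒≡2+ (≡.subst (2 ≤_) (≡.sym q≡p^r) (prime^suc≥2 p-prime r))
... | m , ≡.refl = Curve.classification K isField _≈?_ m fermat frobenius-q 3≈0⇔q%3≡0 nonzero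
  where open PrimePowerField K isField {r = r} p-prime q≡p^r card
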